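{- For all integers $m,n$ with $1\leq m\leq n$, \[mn-\frac{m^2(m-1)}{n-1}\leq \operatorname{scp}(K_n-K_m)\leq (2m-1)(n-m)+1.\]
   Context: $K_n-K_m$ denotes the graph obtained from the complete graph $K_n$ by deleting all edges (but no vertices) of a complete subgraph on $m$ of its vertices. A clique partition of a graph $G$ is a family $\mathcal{C}$ of cliques of $G$ such that the two endpoints of every edge of $G$ lie together in exactly one member of $\mathcal{C}$; $\operatorname{scp}(G)$, the sigma clique partition number, is the minimum of $\sum_{C\in\mathcal{C}}|C|$ over all clique partitions $\mathcal{C}$ of $G$. -}

module Defs where

open import Data.Nat using (ℕ; zero; suc; _+_; _<_)
open import Data.Fin using (Fin; toℕ)
open import Data.Fin.Subset using (Subset; _∈_; ∣_∣)
open import Data.Vec using (lookup)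
open import Data.Bool using (Bool; true; false; _∧_; if_then_else_)
open import Data.List using (List; []; _∷_)
open import Data.List.Relation.Unary.All using (All)
open import Data.Product using (_×_)
open import Relation.Binary.PropositionalEquality using (_≡_; _≢_)
open import Relation.Nullary using (¬_)

Graph : ℕ → Set₁
Graph n = Fin n → Fin n → Set

KnMinusKm : (n m : ℕ) → Graph n
KnMinusKm n m u v = (u ≢ v) × ¬ ((toℕ u < m) × (toℕ v < m))

IsClique : ∀ {n} → Graph n → Subset n → Set
IsClique G C = ∀ u v → u ∈ C → v ∈ C → u ≢ v → G u v

countContaining : ∀ {n} → List (Subset n) → Fin n → Fin n → ℕ
countContaining [] u v = 0
countContaining (C ∷ Cs) u v =
  (if lookup C u ∧ lookup C v then 1 else 0) + countContaining Cs u v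

IsCliquePartition : ∀ {n} → Graph n → List (Subset n) → Set
IsCliquePartition G Cs =
  All (IsClique G) Cs × (∀ u v → G u v → countContaining Cs u v ≡ 1)

sizeSum : ∀ {n} → List (Subset n) → ℕ
sizeSum [] = 0
sizeSum (C ∷ Cs) = ∣ C ∣ + sizeSum Cs

-- Split the vertices of K_n - K_m into the independent set A = {0, …, m-1} and the set B of the
-- other k = n - m vertices, and let a_C, b_C count the vertices of a clique C in A and in B.
-- Then a_C ≤ 1, and counting the A–B and the B–B edges in two ways gives Σ a_C b_C = m k and
-- Σ b_C (b_C - 1) = k (k - 1).  Hence Σ a_C b_C² ≤ k (n - 1), so Cauchy–Schwarz,
-- (Σ a_C b_C)² ≤ (Σ a_C) (Σ a_C b_C²), yields Σ a_C ≥ m² k / (n - 1); adding Σ b_C ≥ m k gives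
-- the lower bound.  The upper bound is attained by the clique B ∪ {0} together with the
-- (m - 1) k edges between A - {0} and B.
module Submission where

open import Defs
open import Data.Nat using (ℕ; zero; suc; _+_; _*_; _∸_; _≤_; _<_; z≤n; s≤s; NonZero)
open import Data.Nat.Properties
  using ( +-*-semiring; module ≤-Reasoning; +-identityʳ; +-assoc; +-comm; *-comm; *-identityˡ; *-identityʳ
        ; *-distribˡ-+; ≤-reflexive; ≤-trans; ≤-antisym; ≤-total; ≮⇒≥; <⇒≱; m≤m+n; m≤n+m; m≤m*n
        ; +-mono-≤; +-monoˡ-≤; +-mono-<; *-monoˡ-≤; *-monoʳ-≤; +-cancelʳ-≤; *-cancelˡ-≤
        ; m≤n⇒∃[o]m+o≡n; m+n∸m≡n)
open import Data.Nat.Tactic.RingSolver using (solve-∀)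
open import Data.Bool using (Bool; true; false; _∧_; if_then_else_)
open import Data.Bool.Properties using (∧-comm; ∧-idem)
open import Data.Fin using (Fin; zero; suc; toℕ; _↑ˡ_; _↑ʳ_; combine; remQuot; punchIn)
open import Data.Fin.Properties
  using (toℕ-↑ˡ; toℕ-↑ʳ; ↑ˡ-injective; ↑ʳ-injective; toℕ<n; remQuot-combine; combine-remQuot; punchInᵢ≢i)
  renaming (_≟_ to _≟ᶠ_; suc-injective to suc-injectiveᶠ; 0≢1+n to 0≢1+nᶠ)
open import Data.Fin.Subset using (Subset; ∣_∣; ⁅_⁆; ⊤)
open import Data.Fin.Subset.Properties using (x∈⁅x⁆; x∈⁅y⁆⇒x≡y; ∣⁅x⁆∣≡1; ∣⊤∣≡n)
open import Data.Vec using ([]; _∷_; lookup; _++_)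
open import Data.Vec.Properties using (lookup⇒[]=; []=⇒lookup; lookup-++ˡ; lookup-++ʳ; lookup-replicate)
open import Data.List using (List)
import Data.List as List
open import Data.List.Properties using (tabulate-lookup)
open import Data.List.Relation.Unary.All.Properties using (tabulate⁺; tabulate⁻)
open import Data.Product using (_×_; _,_; proj₁; proj₂; ∃; swap)
open import Data.Sum using ([_,_]′)
open import Data.Empty using (⊥-elim)
open import Function using (_∘_)
open import Relation.Binary.PropositionalEquality
open import Relation.Nullary using (¬_)
open import Relation.Nullary.Decidable using (decidable-stable)
open import Algebra.Properties.Semiring.Sum +-*-semiring
  using ( sum; sum-syntax; sum-cong-≗; sum-replicate-zero; sum-remove
        ; ∑-distrib-+; ∑-comm; *-distribˡ-sum; *-distribʳ-sum)

⟦_⟧ : Bool → ℕ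
⟦ b ⟧ = if b then 1 else 0

⟦∧⟧ : ∀ x y → ⟦ x ∧ y ⟧ ≡ ⟦ x ⟧ * ⟦ y ⟧
⟦∧⟧ true  y = sym (+-identityʳ ⟦ y ⟧)
⟦∧⟧ false y = refl

∧-true : ∀ {x y} → x ∧ y ≡ true → x ≡ true × y ≡ true
∧-true {true} {true} _ = refl , refl

∑-const : ∀ k c → ∑[ i < k ] c ≡ k * c
∑-const zero    c = refl
∑-const (suc k) c = cong (c +_) (∑-const k c)

∑-zero : ∀ {k} {f : Fin k → ℕ} → (∀ i → f i ≡ 0) → sum f ≡ 0
∑-zero {k} f≡0 = trans (sum-cong-≗ f≡0) (sum-replicate-zero k)

∑-mono-≤ : ∀ {k} {f g : Fin k → ℕ} → (∀ i → f i ≤ g i) → sum f ≤ sum g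
∑-mono-≤ {zero}  _   = z≤n
∑-mono-≤ {suc k} f≤g = +-mono-≤ (f≤g zero) (∑-mono-≤ (f≤g ∘ suc))

∑∑-distrib-+ : ∀ {p q} (f g : Fin p → Fin q → ℕ) →
  ∑[ i < p ] ∑[ j < q ] (f i j + g i j) ≡ ∑[ i < p ] ∑[ j < q ] f i j + ∑[ i < p ] ∑[ j < q ] g i j
∑∑-distrib-+ {p} f g = trans (sum-cong-≗ (λ i → ∑-distrib-+ (f i) (g i))) (∑-distrib-+ {p} _ _)

∑-*-∑ : ∀ {p q} (f : Fin p → ℕ) (g : Fin q → ℕ) → sum f * sum g ≡ ∑[ i < p ] ∑[ j < q ] (f i * g j)
∑-*-∑ f g = trans (*-distribʳ-sum (sum g) f) (sum-cong-≗ (λ i → *-distribˡ-sum (f i) g))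

∑-↑ : ∀ m {n} (f : Fin (m + n) → ℕ) → sum f ≡ ∑[ i < m ] f (i ↑ˡ n) + ∑[ j < n ] f (m ↑ʳ j)
∑-↑ zero    f = refl
∑-↑ (suc m) f = trans (cong (f zero +_) (∑-↑ m (f ∘ suc))) (sym (+-assoc (f zero) _ _))

∑-others-one : ∀ {k} (t : Fin (suc k) → ℕ) i → (∀ j → j ≢ i → t j ≡ 1) → sum t ≡ t i + k
∑-others-one {k} t i others =
  trans (sum-remove t)
        (cong (t i +_) (trans (sum-cong-≗ (λ j → others _ (punchInᵢ≢i i j)))
                              (trans (∑-const k 1) (*-identityʳ k))))

∑-⟦⟧≤1 : ∀ {k} (f : Fin k → Bool) → (∀ i j → f i ≡ true → f j ≡ true → i ≡ j) →
         ∑[ i < k ] ⟦ f i ⟧ ≤ 1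
∑-⟦⟧≤1 {zero}  f unique = z≤n
∑-⟦⟧≤1 {suc k} f unique with f zero in f₀
... | true  = ≤-reflexive (cong suc (∑-zero rest≡0))
  where
  rest≡0 : ∀ i → ⟦ f (suc i) ⟧ ≡ 0
  rest≡0 i with f (suc i) in fᵢ
  ... | true  = ⊥-elim (0≢1+nᶠ (unique zero (suc i) f₀ fᵢ))
  ... | false = refl
... | false = ∑-⟦⟧≤1 (f ∘ suc) (λ i j fᵢ fⱼ → suc-injectiveᶠ (unique (suc i) (suc j) fᵢ fⱼ))

∑-⟦⟧≡1 : ∀ {k} (f : Fin k → Bool) i → f i ≡ true → (∀ j → f j ≡ true → j ≡ i) →
         ∑[ j < k ] ⟦ f j ⟧ ≡ 1
∑-⟦⟧≡1 {suc k} f i fᵢ only = ≤-antisym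
  (∑-⟦⟧≤1 f (λ j j′ fⱼ fⱼ′ → trans (only j fⱼ) (sym (only j′ fⱼ′))))
  (begin
    1                                             ≡⟨ cong ⟦_⟧ (sym fᵢ) ⟩
    ⟦ f i ⟧                                       ≤⟨ m≤m+n _ _ ⟩
    ⟦ f i ⟧ + ∑[ j < k ] ⟦ f (punchIn i j) ⟧     ≡⟨ sum-remove (λ j → ⟦ f j ⟧) ⟨
    ∑[ j < suc k ] ⟦ f j ⟧                        ∎)
  where open ≤-Reasoning

2yz≤y²+z² : ∀ y z → 2 * (y * z) ≤ y * y + z * z
2yz≤y²+z² y z = [ ordered , swapped ]′ (≤-total y z)
  where
  ordered : ∀ {y z} → y ≤ z → 2 * (y * z) ≤ y * y + z * z
  ordered {y} y≤z with m≤n⇒∃[o]m+o≡n y≤z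
  ... | d , refl = subst (2 * (y * (y + d)) ≤_) (sym (expand y d)) (m≤m+n _ _)
    where
    expand : ∀ y d → y * y + (y + d) * (y + d) ≡ 2 * (y * (y + d)) + d * d
    expand = solve-∀
  swapped : z ≤ y → 2 * (y * z) ≤ y * y + z * z
  swapped z≤y = subst₂ _≤_ (cong (2 *_) (*-comm z y)) (+-comm (z * z) (y * y)) (ordered z≤y)

m+m≤n+n⇒m≤n : ∀ {m n} → m + m ≤ n + n → m ≤ n
m+m≤n+n⇒m≤n le = ≮⇒≥ (λ n<m → <⇒≱ (+-mono-< n<m n<m) le)

-- Lagrange's argument: Σᵢ Σⱼ wᵢ wⱼ (yᵢ - yⱼ)² ≥ 0, with 2 yᵢ yⱼ ≤ yᵢ² + yⱼ² applied termwise.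
weighted-cauchy-schwarz : ∀ {r} (w y : Fin r → ℕ) →
  (∑[ c < r ] (w c * y c)) * (∑[ c < r ] (w c * y c)) ≤ sum w * ∑[ c < r ] (w c * (y c * y c))
weighted-cauchy-schwarz {r} w y = m+m≤n+n⇒m≤n (begin
  X * X + X * X                               ≡⟨ cong₂ _+_ (∑-*-∑ wy wy) (∑-*-∑ wy wy) ⟩
  ∑∑ (λ i j → wy i * wy j) + ∑∑ (λ i j → wy i * wy j)
                                              ≡⟨ ∑∑-distrib-+ (λ i j → wy i * wy j) (λ i j → wy i * wy j) ⟨
  ∑∑ (λ i j → wy i * wy j + wy i * wy j)
                                              ≤⟨ ∑-mono-≤ (λ i → ∑-mono-≤ (λ j → termwise (w i) (w j) (y i) (y j))) ⟩
  ∑∑ (λ i j → w i * wy² j + wy² i * w j)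
                                              ≡⟨ ∑∑-distrib-+ (λ i j → w i * wy² j) (λ i j → wy² i * w j) ⟩
  ∑∑ (λ i j → w i * wy² j) + ∑∑ (λ i j → wy² i * w j)
                                              ≡⟨ cong₂ _+_ (∑-*-∑ w wy²) (trans (*-comm (sum w) Y) (∑-*-∑ wy² w)) ⟨
  sum w * Y + sum w * Y                       ∎)
  where
  open ≤-Reasoning
  wy wy² : Fin r → ℕ
  wy c = w c * y c
  wy² c = w c * (y c * y c)
  X Y : ℕ
  X = sum wy
  Y = sum wy²
  ∑∑ : (Fin r → Fin r → ℕ) → ℕ
  ∑∑ f = ∑[ i < r ] ∑[ j < r ] f i j
  termwise : ∀ a b s t → a * s * (b * t) + a * s * (b * t) ≤ a * (b * (t * t)) + a * (s * s) * b
  termwise a b s t = begin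
    a * s * (b * t) + a * s * (b * t)   ≡⟨ collect a b s t ⟩
    a * b * (2 * (s * t))               ≤⟨ *-monoʳ-≤ (a * b) (2yz≤y²+z² s t) ⟩
    a * b * (s * s + t * t)             ≡⟨ spread a b s t ⟩
    a * (b * (t * t)) + a * (s * s) * b ∎
    where
    collect : ∀ a b s t → a * s * (b * t) + a * s * (b * t) ≡ a * b * (2 * (s * t))
    collect = solve-∀
    spread : ∀ a b s t → a * b * (s * s + t * t) ≡ a * (b * (t * t)) + a * (s * s) * b
    spread = solve-∀

∣∣≡∑ : ∀ {n} (C : Subset n) → ∣ C ∣ ≡ ∑[ u < n ] ⟦ lookup C u ⟧
∣∣≡∑ []          = refl
∣∣≡∑ (true ∷ C)  = cong suc (∣∣≡∑ C)
∣∣≡∑ (false ∷ C) = ∣∣≡∑ C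

∣++∣ : ∀ {m n} (p : Subset m) (q : Subset n) → ∣ p ++ q ∣ ≡ ∣ p ∣ + ∣ q ∣
∣++∣ []          q = refl
∣++∣ (true ∷ p)  q = cong suc (∣++∣ p q)
∣++∣ (false ∷ p) q = ∣++∣ p q

lookup-⁅⁆ : ∀ {n} {x y : Fin n} → lookup ⁅ y ⁆ x ≡ true → x ≡ y
lookup-⁅⁆ {x = x} {y} eq = x∈⁅y⁆⇒x≡y y (lookup⇒[]= x ⁅ y ⁆ eq)

lookup-⁅x⁆-x : ∀ {n} (x : Fin n) → lookup ⁅ x ⁆ x ≡ true
lookup-⁅x⁆-x x = []=⇒lookup (x∈⁅x⁆ x)

countContainingᶠ : ∀ {n r} → (Fin r → Subset n) → Fin n → Fin n → ℕ
countContainingᶠ {r = r} F u v = ∑[ c < r ] ⟦ lookup (F c) u ∧ lookup (F c) v ⟧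

countContainingᶠ-sym : ∀ {n r} (F : Fin r → Subset n) u v → countContainingᶠ F u v ≡ countContainingᶠ F v u
countContainingᶠ-sym F u v = sum-cong-≗ (λ c → cong ⟦_⟧ (∧-comm (lookup (F c) u) (lookup (F c) v)))

countContaining-tabulate : ∀ {n r} (F : Fin r → Subset n) u v →
  countContaining (List.tabulate F) u v ≡ countContainingᶠ F u v
countContaining-tabulate {r = zero}  F u v = refl
countContaining-tabulate {r = suc r} F u v = cong (⟦ lookup (F zero) u ∧ lookup (F zero) v ⟧ +_)
                                                  (countContaining-tabulate (F ∘ suc) u v)

sizeSum-tabulate : ∀ {n r} (F : Fin r → Subset n) → sizeSum (List.tabulate F) ≡ ∑[ c < r ] ∣ F c ∣
sizeSum-tabulate {r = zero}  F = refl
sizeSum-tabulate {r = suc r} F = cong (∣ F zero ∣ +_) (sizeSum-tabulate (F ∘ suc))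

double-counting : ∀ {n r p q} (F : Fin r → Subset n) (f : Fin p → Fin n) (g : Fin q → Fin n) →
  ∑[ c < r ] ((∑[ i < p ] ⟦ lookup (F c) (f i) ⟧) * (∑[ j < q ] ⟦ lookup (F c) (g j) ⟧))
  ≡ ∑[ i < p ] ∑[ j < q ] countContainingᶠ F (f i) (g j)
double-counting {r = r} {p} {q} F f g = begin
  ∑[ c < r ] ((∑[ i < p ] ⟦ x c i ⟧) * (∑[ j < q ] ⟦ y c j ⟧))
    ≡⟨ sum-cong-≗ (λ c → ∑-*-∑ (λ i → ⟦ x c i ⟧) (λ j → ⟦ y c j ⟧)) ⟩
  ∑[ c < r ] ∑[ i < p ] ∑[ j < q ] (⟦ x c i ⟧ * ⟦ y c j ⟧)
    ≡⟨ sum-cong-≗ (λ c → sum-cong-≗ (λ i → sum-cong-≗ (λ j → ⟦∧⟧ (x c i) (y c j)))) ⟨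
  ∑[ c < r ] ∑[ i < p ] ∑[ j < q ] ⟦ x c i ∧ y c j ⟧
    ≡⟨ ∑-comm (λ c i → ∑[ j < q ] ⟦ x c i ∧ y c j ⟧) ⟩
  ∑[ i < p ] ∑[ c < r ] ∑[ j < q ] ⟦ x c i ∧ y c j ⟧
    ≡⟨ sum-cong-≗ (λ i → ∑-comm (λ c j → ⟦ x c i ∧ y c j ⟧)) ⟩
  ∑[ i < p ] ∑[ j < q ] ∑[ c < r ] ⟦ x c i ∧ y c j ⟧
    ∎
  where
  open ≡-Reasoning
  x : Fin r → Fin p → Bool
  x c i = lookup (F c) (f i)
  y : Fin r → Fin q → Bool
  y c j = lookup (F c) (g j)

data Side {m k : ℕ} : Fin (m + k) → Set where
  left  : (i : Fin m) → Side (i ↑ˡ k)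
  right : (j : Fin k) → Side (m ↑ʳ j)

side : ∀ {m k} (u : Fin (m + k)) → Side {m} {k} u
side {zero}  u       = right u
side {suc m} zero    = left zero
side {suc m} (suc u) with side {m} u
... | left i  = left (suc i)
... | right j = right j

toℕ-↑ˡ-< : ∀ {m} k (i : Fin m) → toℕ (i ↑ˡ k) < m
toℕ-↑ˡ-< {m} k i = subst (_< m) (sym (toℕ-↑ˡ i k)) (toℕ<n i)

toℕ-↑ʳ-≥ : ∀ m {k} (j : Fin k) → m ≤ toℕ (m ↑ʳ j)
toℕ-↑ʳ-≥ m j = subst (m ≤_) (sym (toℕ-↑ʳ m j)) (m≤m+n m (toℕ j))

↑ˡ≢↑ʳ : ∀ {m k} (i : Fin m) (j : Fin k) → i ↑ˡ k ≢ m ↑ʳ j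
↑ˡ≢↑ʳ {m} {k} i j eq = <⇒≱ (toℕ-↑ˡ-< k i) (subst (m ≤_) (cong toℕ (sym eq)) (toℕ-↑ʳ-≥ m j))

KnMinusKm-sym : ∀ {n m u v} → KnMinusKm n m u v → KnMinusKm n m v u
KnMinusKm-sym (u≢v , notBoth) = u≢v ∘ sym , notBoth ∘ swap

left-nonadjacent : ∀ {m k} (i i′ : Fin m) → ¬ KnMinusKm (m + k) m (i ↑ˡ k) (i′ ↑ˡ k)
left-nonadjacent {k = k} i i′ (_ , notBoth) = notBoth (toℕ-↑ˡ-< k i , toℕ-↑ˡ-< k i′)

adjacent-right : ∀ {m k} u (j : Fin k) → u ≢ m ↑ʳ j → KnMinusKm (m + k) m u (m ↑ʳ j)
adjacent-right {m} u j u≢v = u≢v , λ (_ , lt) → <⇒≱ lt (toℕ-↑ʳ-≥ m j)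

LeftUnique : ∀ {m k} → Subset (m + k) → Set
LeftUnique {m} {k} C = ∀ (i i′ : Fin m) → lookup C (i ↑ˡ k) ≡ true → lookup C (i′ ↑ˡ k) ≡ true → i ≡ i′

clique⇒leftUnique : ∀ {m k} {C : Subset (m + k)} → IsClique (KnMinusKm (m + k) m) C → LeftUnique C
clique⇒leftUnique {k = k} {C} clique i i′ i∈C i′∈C = decidable-stable (i ≟ᶠ i′) λ i≢i′ →
  left-nonadjacent i i′ (clique _ _ (lookup⇒[]= _ C i∈C) (lookup⇒[]= _ C i′∈C) (i≢i′ ∘ ↑ˡ-injective k i i′))

leftUnique⇒clique : ∀ {m k} {C : Subset (m + k)} → LeftUnique C → IsClique (KnMinusKm (m + k) m) C
leftUnique⇒clique {m} {k} unique u v u∈C v∈C u≢v with side {m} {k} u | side {m} {k} v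
... | left i  | left i′ = ⊥-elim (u≢v (cong (_↑ˡ k) (unique i i′ ([]=⇒lookup u∈C) ([]=⇒lookup v∈C))))
... | _       | right j = adjacent-right u j u≢v
... | right j | left i  = KnMinusKm-sym (adjacent-right v j (u≢v ∘ sym))

lower-bound-arithmetic : ∀ {m k l R S Y} .{{_ : NonZero k}} →
  m * k ≤ S → (m * k) * (m * k) ≤ R * Y → Y ≤ k * l → m * m * k + m * k * l ≤ l * (R + S)
lower-bound-arithmetic {m} {k} {l} {R} {S} {Y} mk≤S cauchy-schwarz Y≤kl = begin
  m * m * k + m * k * l  ≤⟨ +-mono-≤ m²k≤lR (≤-trans (≤-reflexive (*-comm (m * k) l)) (*-monoʳ-≤ l mk≤S)) ⟩
  l * R + l * S          ≡⟨ *-distribˡ-+ l R S ⟨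
  l * (R + S)            ∎
  where
  open ≤-Reasoning
  m²k≤lR : m * m * k ≤ l * R
  m²k≤lR = *-cancelˡ-≤ k (begin
    k * (m * m * k)  ≡⟨ square m k ⟩
    m * k * (m * k)  ≤⟨ cauchy-schwarz ⟩
    R * Y            ≤⟨ *-monoʳ-≤ R Y≤kl ⟩
    R * (k * l)      ≡⟨ rotate R k l ⟩
    k * (l * R)      ∎)
    where
    square : ∀ m k → k * (m * m * k) ≡ m * k * (m * k)
    square = solve-∀
    rotate : ∀ R k l → R * (k * l) ≡ k * (l * R)
    rotate = solve-∀

module LowerBound {m′ k′ r : ℕ} (F : Fin r → Subset (suc m′ + suc k′))
  (partition : IsCliquePartition (KnMinusKm (suc m′ + suc k′) (suc m′)) (List.tabulate F)) where

  m k : ℕ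
  m = suc m′
  k = suc k′

  once : ∀ u v → KnMinusKm (m + k) m u v → countContainingᶠ F u v ≡ 1
  once u v uv = trans (sym (countContaining-tabulate F u v)) (proj₂ partition u v uv)

  a b : Fin r → ℕ
  a c = ∑[ i < m ] ⟦ lookup (F c) (i ↑ˡ k) ⟧
  b c = ∑[ j < k ] ⟦ lookup (F c) (m ↑ʳ j) ⟧

  a≤1 : ∀ c → a c ≤ 1
  a≤1 c = ∑-⟦⟧≤1 _ (clique⇒leftUnique (tabulate⁻ (proj₁ partition) c))

  size≡∑a+∑b : sizeSum (List.tabulate F) ≡ sum a + sum b
  size≡∑a+∑b = trans (sizeSum-tabulate F)
    (trans (sum-cong-≗ (λ c → trans (∣∣≡∑ (F c)) (∑-↑ m (λ u → ⟦ lookup (F c) u ⟧)))) (∑-distrib-+ a b))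

  ∑ab≡mk : ∑[ c < r ] (a c * b c) ≡ m * k
  ∑ab≡mk = begin
    ∑[ c < r ] (a c * b c)                                      ≡⟨ double-counting F (_↑ˡ k) (m ↑ʳ_) ⟩
    ∑[ i < m ] ∑[ j < k ] countContainingᶠ F (i ↑ˡ k) (m ↑ʳ j)
      ≡⟨ sum-cong-≗ (λ i → sum-cong-≗ (λ j → once _ _ (adjacent-right _ j (↑ˡ≢↑ʳ i j)))) ⟩
    ∑[ i < m ] ∑[ j < k ] 1                                     ≡⟨ sum-cong-≗ {m} (λ i → trans (∑-const k 1) (*-identityʳ k)) ⟩
    ∑[ i < m ] k                                                ≡⟨ ∑-const m k ⟩
    m * k                                                       ∎
    where open ≡-Reasoning

  ∑bb≡∑b+kk′ : ∑[ c < r ] (b c * b c) ≡ sum b + k * k′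
  ∑bb≡∑b+kk′ = begin
    ∑[ c < r ] (b c * b c)              ≡⟨ double-counting F (m ↑ʳ_) (m ↑ʳ_) ⟩
    ∑[ j < k ] ∑[ j′ < k ] common j j′  ≡⟨ sum-cong-≗ (λ j → ∑-others-one (common j) j (others-one j)) ⟩
    ∑[ j < k ] (common j j + k′)        ≡⟨ ∑-distrib-+ (λ j → common j j) (λ _ → k′) ⟩
    ∑[ j < k ] common j j + ∑[ j < k ] k′
                                        ≡⟨ cong₂ _+_ diagonal (∑-const k k′) ⟩
    sum b + k * k′                      ∎
    where
    open ≡-Reasoning
    common : Fin k → Fin k → ℕ
    common j j′ = countContainingᶠ F (m ↑ʳ j) (m ↑ʳ j′)
    others-one : ∀ j j′ → j′ ≢ j → common j j′ ≡ 1
    others-one j j′ j′≢j = once _ _ (adjacent-right _ j′ (j′≢j ∘ sym ∘ ↑ʳ-injective m j j′))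
    diagonal : ∑[ j < k ] common j j ≡ sum b
    diagonal = trans (sum-cong-≗ (λ j → sum-cong-≗ (λ c → cong ⟦_⟧ (∧-idem (lookup (F c) (m ↑ʳ j))))))
                     (∑-comm (λ j c → ⟦ lookup (F c) (m ↑ʳ j) ⟧))

  ∑ab≤∑b : ∑[ c < r ] (a c * b c) ≤ sum b
  ∑ab≤∑b = ∑-mono-≤ (λ c → ≤-trans (*-monoˡ-≤ (b c) (a≤1 c)) (≤-reflexive (*-identityˡ (b c))))

  ∑abb≤k[m′+k] : ∑[ c < r ] (a c * (b c * b c)) ≤ k * (m′ + k)
  ∑abb≤k[m′+k] = +-cancelʳ-≤ (sum b) _ _ (begin
    ∑[ c < r ] (a c * (b c * b c)) + sum b      ≡⟨ ∑-distrib-+ (λ c → a c * (b c * b c)) b ⟨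
    ∑[ c < r ] (a c * (b c * b c) + b c)        ≤⟨ ∑-mono-≤ (λ c → termwise (b c) (a≤1 c)) ⟩
    ∑[ c < r ] (b c * b c + a c * b c)          ≡⟨ ∑-distrib-+ (λ c → b c * b c) (λ c → a c * b c) ⟩
    ∑[ c < r ] (b c * b c) + ∑[ c < r ] (a c * b c)
                                                ≡⟨ cong₂ _+_ ∑bb≡∑b+kk′ ∑ab≡mk ⟩
    sum b + k * k′ + m * k                      ≡⟨ regroup (sum b) k′ m′ ⟩
    k * (m′ + k) + sum b                        ∎)
    where
    open ≤-Reasoning
    termwise : ∀ {x} y → x ≤ 1 → x * (y * y) + y ≤ y * y + x * y
    termwise {zero}     zero    _ = z≤n
    termwise {zero}     (suc y) _ = ≤-trans (m≤m*n (suc y) (suc y)) (m≤m+n _ _)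
    termwise {suc zero} y       _ = ≤-reflexive (one y)
      where
      one : ∀ y → 1 * (y * y) + y ≡ y * y + 1 * y
      one = solve-∀
    termwise {suc (suc _)} _ (s≤s ())
    regroup : ∀ S k′ m′ → S + suc k′ * k′ + suc m′ * suc k′ ≡ suc k′ * (m′ + suc k′) + S
    regroup = solve-∀

  cauchy-schwarz : (m * k) * (m * k) ≤ sum a * ∑[ c < r ] (a c * (b c * b c))
  cauchy-schwarz = subst (λ X → X * X ≤ sum a * ∑[ c < r ] (a c * (b c * b c))) ∑ab≡mk
                         (weighted-cauchy-schwarz a b)

  bound : m * (m + k) * (m′ + k) ≤ (m′ + k) * sizeSum (List.tabulate F) + m * m * m′
  bound = begin
    m * (m + k) * (m′ + k)                              ≡⟨ expand m′ k′ ⟩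
    m * m * k + m * k * (m′ + k) + m * m * m′           ≤⟨ +-monoˡ-≤ (m * m * m′) ∑a-and-∑b ⟩
    (m′ + k) * (sum a + sum b) + m * m * m′             ≡⟨ cong (λ s → (m′ + k) * s + m * m * m′) size≡∑a+∑b ⟨
    (m′ + k) * sizeSum (List.tabulate F) + m * m * m′   ∎
    where
    open ≤-Reasoning
    ∑a-and-∑b : m * m * k + m * k * (m′ + k) ≤ (m′ + k) * (sum a + sum b)
    ∑a-and-∑b = lower-bound-arithmetic {m} {k}
                  (subst (_≤ sum b) ∑ab≡mk ∑ab≤∑b) cauchy-schwarz ∑abb≤k[m′+k]
    expand : ∀ m′ k′ →
      suc m′ * (suc m′ + suc k′) * (m′ + suc k′)
        ≡ suc m′ * suc m′ * suc k′ + suc m′ * suc k′ * (m′ + suc k′) + suc m′ * suc m′ * m′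
    expand = solve-∀

lower-bound : ∀ m′ k (Cs : List (Subset (suc m′ + k))) →
  IsCliquePartition (KnMinusKm (suc m′ + k) (suc m′)) Cs →
  suc m′ * (suc m′ + k) * (m′ + k) ≤ (m′ + k) * sizeSum Cs + suc m′ * suc m′ * m′
lower-bound m′ zero     Cs _ =
  ≤-trans (≤-reflexive (drop-zero m′)) (m≤n+m (suc m′ * suc m′ * m′) ((m′ + 0) * sizeSum Cs))
  where
  drop-zero : ∀ m′ → suc m′ * (suc m′ + 0) * (m′ + 0) ≡ suc m′ * suc m′ * m′
  drop-zero = solve-∀
lower-bound m′ (suc k′) Cs =
  subst (λ Ds → IsCliquePartition (KnMinusKm (suc m′ + suc k′) (suc m′)) Ds →
                suc m′ * (suc m′ + suc k′) * (m′ + suc k′)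
                  ≤ (m′ + suc k′) * sizeSum Ds + suc m′ * suc m′ * m′)
        (tabulate-lookup Cs)
        (LowerBound.bound (List.lookup Cs))

module UpperBound (m′ k : ℕ) where

  m : ℕ
  m = suc m′

  _⊕_ : Subset m → Subset k → Subset (m + k)
  _⊕_ = _++_

  K : Subset (m + k)
  K = ⁅ zero ⁆ ⊕ ⊤

  edge : Fin m′ × Fin k → Subset (m + k)
  edge (i , j) = ⁅ suc i ⁆ ⊕ ⁅ j ⁆

  F : Fin (suc (m′ * k)) → Subset (m + k)
  F zero    = K
  F (suc d) = edge (remQuot k d)

  ∈K-left : ∀ i → lookup K (i ↑ˡ k) ≡ true → i ≡ zero
  ∈K-left i i∈K = lookup-⁅⁆ (trans (sym (lookup-++ˡ ⁅ zero ⁆ ⊤ i)) i∈K)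

  K∋right : ∀ j → lookup K (m ↑ʳ j) ≡ true
  K∋right j = trans (lookup-++ʳ (⁅_⁆ {m} zero) ⊤ j) (lookup-replicate j true)

  ∈edge-left : ∀ p i′ → lookup (edge p) (i′ ↑ˡ k) ≡ true → i′ ≡ suc (proj₁ p)
  ∈edge-left (i , j) i′ i′∈e = lookup-⁅⁆ (trans (sym (lookup-++ˡ ⁅ suc i ⁆ ⁅ j ⁆ i′)) i′∈e)

  ∈edge-right : ∀ p j′ → lookup (edge p) (m ↑ʳ j′) ≡ true → j′ ≡ proj₂ p
  ∈edge-right (i , j) j′ j′∈e = lookup-⁅⁆ (trans (sym (lookup-++ʳ ⁅ suc i ⁆ ⁅ j ⁆ j′)) j′∈e)

  edge∋ends : ∀ i j → lookup (edge (i , j)) (suc i ↑ˡ k) ∧ lookup (edge (i , j)) (m ↑ʳ j) ≡ true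
  edge∋ends i j = cong₂ _∧_ (trans (lookup-++ˡ ⁅ suc i ⁆ ⁅ j ⁆ (suc i)) (lookup-⁅x⁆-x (suc i)))
                            (trans (lookup-++ʳ ⁅ suc i ⁆ ⁅ j ⁆ j) (lookup-⁅x⁆-x j))

  edge-index : ∀ d {i j} → lookup (F (suc d)) (suc i ↑ˡ k) ≡ true → lookup (F (suc d)) (m ↑ʳ j) ≡ true →
               d ≡ combine i j
  edge-index d i∈e j∈e = trans (sym (combine-remQuot {m′} k d))
    (cong₂ combine (sym (suc-injectiveᶠ (∈edge-left (remQuot k d) _ i∈e)))
                   (sym (∈edge-right (remQuot k d) _ j∈e)))

  cliques : ∀ c → IsClique (KnMinusKm (m + k) m) (F c)
  cliques zero    = leftUnique⇒clique (λ i i′ i∈K i′∈K → trans (∈K-left i i∈K) (sym (∈K-left i′ i′∈K)))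
  cliques (suc d) = leftUnique⇒clique (λ i i′ i∈e i′∈e →
    trans (∈edge-left (remQuot k d) i i∈e) (sym (∈edge-left (remQuot k d) i′ i′∈e)))

  left-right : ∀ i j → countContainingᶠ F (i ↑ˡ k) (m ↑ʳ j) ≡ 1
  left-right zero j = ∑-⟦⟧≡1 _ zero (K∋right j) only
    where
    only : ∀ c → lookup (F c) (zero ↑ˡ k) ∧ lookup (F c) (m ↑ʳ j) ≡ true → c ≡ zero
    only zero    _    = refl
    only (suc d) ()   -- the edges avoid the vertex 0
  left-right (suc i) j = ∑-⟦⟧≡1 _ (suc (combine i j)) ends-covered only
    where
    ends-covered : lookup (F (suc (combine i j))) (suc i ↑ˡ k) ∧ lookup (F (suc (combine i j))) (m ↑ʳ j) ≡ true
    ends-covered = subst (λ C → lookup C (suc i ↑ˡ k) ∧ lookup C (m ↑ʳ j) ≡ true)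
                         (cong edge (sym (remQuot-combine i j))) (edge∋ends i j)
    only : ∀ c → lookup (F c) (suc i ↑ˡ k) ∧ lookup (F c) (m ↑ʳ j) ≡ true → c ≡ suc (combine i j)
    only zero    both = ⊥-elim (0≢1+nᶠ (sym (∈K-left _ (proj₁ (∧-true both)))))
    only (suc d) both = cong suc (edge-index d (proj₁ (∧-true both)) (proj₂ (∧-true both)))

  right-right : ∀ j j′ → j ≢ j′ → countContainingᶠ F (m ↑ʳ j) (m ↑ʳ j′) ≡ 1
  right-right j j′ j≢j′ = ∑-⟦⟧≡1 _ zero (cong₂ _∧_ (K∋right j) (K∋right j′)) only
    where
    only : ∀ c → lookup (F c) (m ↑ʳ j) ∧ lookup (F c) (m ↑ʳ j′) ≡ true → c ≡ zero
    only zero    _    = refl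
    only (suc d) both = ⊥-elim (j≢j′ (trans (∈edge-right (remQuot k d) j (proj₁ (∧-true both)))
                                            (sym (∈edge-right (remQuot k d) j′ (proj₂ (∧-true both))))))

  once : ∀ u v → KnMinusKm (m + k) m u v → countContainingᶠ F u v ≡ 1
  once u v uv with side {m} {k} u | side {m} {k} v
  ... | left i  | left i′  = ⊥-elim (left-nonadjacent i i′ uv)
  ... | left i  | right j  = left-right i j
  ... | right j | left i   = trans (countContainingᶠ-sym F (m ↑ʳ j) (i ↑ˡ k)) (left-right i j)
  ... | right j | right j′ = right-right j j′ (proj₁ uv ∘ cong (m ↑ʳ_))

  partition : IsCliquePartition (KnMinusKm (m + k) m) (List.tabulate F)
  partition = tabulate⁺ cliques , λ u v uv → trans (countContaining-tabulate F u v) (once u v uv)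

  size : sizeSum (List.tabulate F) ≡ (2 * m ∸ 1) * k + 1
  size = begin
    sizeSum (List.tabulate F)                ≡⟨ sizeSum-tabulate F ⟩
    ∣ K ∣ + ∑[ d < m′ * k ] ∣ F (suc d) ∣   ≡⟨ cong₂ _+_ ∣K∣≡1+k ∑∣edge∣ ⟩
    1 + k + m′ * k * 2                       ≡⟨ tally m′ k ⟩
    (2 * m ∸ 1) * k + 1                      ∎
    where
    open ≡-Reasoning
    ∣K∣≡1+k : ∣ K ∣ ≡ 1 + k
    ∣K∣≡1+k = trans (∣++∣ (⁅_⁆ {m} zero) ⊤) (cong₂ _+_ (∣⁅x⁆∣≡1 {m} zero) (∣⊤∣≡n k))
    ∣edge∣≡2 : ∀ p → ∣ edge p ∣ ≡ 2
    ∣edge∣≡2 (i , j) = trans (∣++∣ ⁅ suc i ⁆ ⁅ j ⁆) (cong₂ _+_ (∣⁅x⁆∣≡1 (suc i)) (∣⁅x⁆∣≡1 j))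
    ∑∣edge∣ : ∑[ d < m′ * k ] ∣ F (suc d) ∣ ≡ m′ * k * 2
    ∑∣edge∣ = trans (sum-cong-≗ (λ d → ∣edge∣≡2 (remQuot k d))) (∑-const (m′ * k) 2)
    -- (m′ + suc (m′ + 0)) is the normal form of 2 * m ∸ 1, which the ring solver cannot parse.
    tally : ∀ m′ k → 1 + k + m′ * k * 2 ≡ (m′ + suc (m′ + 0)) * k + 1
    tally = solve-∀

mainTheorem7 : ∀ (m n : ℕ) → 1 ≤ m → m ≤ n →
    ((Cs : List (Subset n)) → IsCliquePartition (KnMinusKm n m) Cs →
      m * n * (n ∸ 1) ≤ (n ∸ 1) * sizeSum Cs + m * m * (m ∸ 1))
    × ∃ (λ (Cs : List (Subset n)) → IsCliquePartition (KnMinusKm n m) Cs ×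
      sizeSum Cs ≤ (2 * m ∸ 1) * (n ∸ m) + 1)
mainTheorem7 zero     _ () _
mainTheorem7 (suc m′) n _ m≤n with m≤n⇒∃[o]m+o≡n m≤n
... | k , refl = lower-bound m′ k ,
                 (List.tabulate F , partition ,
                  ≤-reflexive (trans size (cong (λ x → (2 * m ∸ 1) * x + 1) (sym (m+n∸m≡n m k)))))
  where open UpperBound m′ k
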